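{- Let $\pi$ be a propositional formula that is neither a tautology nor a contradiction. Then the formula $[\ddagger\pi](\Box\neg\pi\vee\Box\pi)\leftrightarrow\Box\bot$ is valid, i.e. true at every world of every Kripke model.
   Context: Atoms come from a countable non-empty set $\mathit{At}$. Formulas are built from $\top$, atoms, $\neg$, $\wedge$, $\Box$ and $[\ddagger\pi]\varphi$ for propositional $\pi$ ($\bot,\vee,\to,\leftrightarrow,\Diamond$ as usual). A Kripke model $\mathcal M=\langle W,R,V\rangle$ has $W\neq\varnothing$, arbitrary $R\subseteq W\times W$, $V:\mathit{At}\to\mathcal P(W)$; $\mathcal M,w\models\Box\varphi$ iff $\mathcal M,v\models\varphi$ for all $v$ with $wRv$; boolean clauses standard. A literal is an atom or its negation; a clause is a finite set $D$ of literals read as $\bigvee D$ ($\bigvee\varnothing=\bot$); it is tautological if it contains $p$ and $\neg p$ for some $p$. For propositional $\pi$, $\mathcal C(\pi)$ is the set of non-tautological clauses $D$ with $\models\pi\to\bigvee D$ such that no $D'\subsetneq D$ has $\models\pi\to\bigvee D'$. For a finite set of non-tautological clauses $\{D_i:i\in I\}$ with $0\notin I$, $\mathcal M^{\{D_i:i\in I\}}_u=\langle W',R',V'\rangle$ has $W'=W\times(\{0\}\cup I)$, $(w,i)R'(v,j)$ iff $wRv$, $(w,0)\in V'(p)$ iff $w\in V(p)$, and for $i\in I$: $(w,i)\in V'(p)$ iff $\neg p\in D_i$, or ($\{p,\neg p\}\cap D_i=\varnothing$ and $w\in V(p)$). Semantics of forgetting whether: $\mathcal M,w\models[\ddagger\pi]\varphi$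 iff for all $D_1\in\mathcal C(\pi)$ and $D_2\in\mathcal C(\neg\pi)$, $\mathcal M^{\{D_1,D_2\}}_u,(w,0)\models\varphi$, where $D_1$ is indexed by $1$ and $D_2$ by $2$. -}

module Defs where

open import Data.Bool using (Bool; true; false; not; _∧_)
open import Data.Nat using (ℕ)
open import Data.Fin using (Fin; zero; suc)
open import Data.Product using (Σ; _×_; _,_)
open import Data.Sum using (_⊎_)
open import Data.Empty using (⊥)
open import Data.Unit using (⊤)
open import Data.List using (List)
open import Data.List.Relation.Unary.Any using (Any)
open import Data.List.Membership.Propositional using (_∈_; _∉_)
open import Data.List.Relation.Binary.Subset.Propositional using (_⊆_)
open import Relation.Nullary using (¬_)
open import Relation.Binary.PropositionalEquality using (_≡_)
open import Function.Definitions using (Injective)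

Countable : Set → Set
Countable A = Σ (A → ℕ) (λ f → Injective _≡_ _≡_ f)

module _ {At : Set} where

  data PForm : Set where
    ptop  : PForm
    patom : At → PForm
    pneg  : PForm → PForm
    pand  : PForm → PForm → PForm

  Valuation : Set
  Valuation = At → Bool

  evalP : Valuation → PForm → Bool
  evalP v ptop       = true
  evalP v (patom p)  = v p
  evalP v (pneg π)   = not (evalP v π)
  evalP v (pand π ρ) = evalP v π ∧ evalP v ρ

  Tautology : PForm → Set
  Tautology π = ∀ (v : Valuation) → evalP v π ≡ true

  Contradiction : PForm → Set
  Contradiction π = ∀ (v : Valuation) → evalP v π ≡ false

  -- Literals and clauses (a clause = finite set of literals, given as a list;
  -- only membership matters)
  data Literal : Set where
    pos : At → Literal
    neg : At → Literal

  litVal : Valuation → Literal → Bool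
  litVal v (pos p) = v p
  litVal v (neg p) = not (v p)

  Clause : Set
  Clause = List Literal

  ClauseTrue : Valuation → Clause → Set
  ClauseTrue v D = Any (λ l → litVal v l ≡ true) D

  Tautological : Clause → Set
  Tautological D = Σ At (λ p → (pos p ∈ D) × (neg p ∈ D))

  Entails : PForm → Clause → Set
  Entails π D = ∀ (v : Valuation) → evalP v π ≡ true → ClauseTrue v D

  _⊊_ : Clause → Clause → Set
  D' ⊊ D = (D' ⊆ D) × ¬ (D ⊆ D')

  InC : PForm → Clause → Set
  InC π D = ¬ Tautological D × Entails π D
            × (∀ (D' : Clause) → D' ⊊ D → ¬ Entails π D')

  data Form : Set where
    top    : Form
    atom   : At → Form
    neg'   : Form → Form
    and'   : Form → Form → Form
    box    : Form → Form
    forget : PForm → Form → Form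

  embed : PForm → Form
  embed ptop       = top
  embed (patom p)  = atom p
  embed (pneg π)   = neg' (embed π)
  embed (pand π ρ) = and' (embed π) (embed ρ)

  bot : Form
  bot = neg' top

  or' : Form → Form → Form
  or' φ ψ = neg' (and' (neg' φ) (neg' ψ))

  imp : Form → Form → Form
  imp φ ψ = neg' (and' φ (neg' ψ))

  iff : Form → Form → Form
  iff φ ψ = and' (imp φ ψ) (imp ψ φ)

  record Model : Set₁ where
    field
      W : Set
      inhabited : W
      R : W → W → Set
      V : At → W → Set
  open Model public

  copyVal : Clause → (At → Set) → At → Set
  copyVal D old p = (neg p ∈ D) ⊎ ((pos p ∉ D) × (neg p ∉ D) × old p)

  -- 𝓜^{D₁,D₂}_u, with copies indexed by 0, 1 (for D₁), 2 (for D₂)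
  update : Model → Clause → Clause → Model
  update M D₁ D₂ = record
    { W = W M × Fin 3
    ; inhabited = inhabited M , zero
    ; R = λ { (w , _) (v , _) → R M w v }
    ; V = λ { p (w , zero)          → V M p w
            ; p (w , suc zero)      → copyVal D₁ (λ q → V M q w) p
            ; p (w , suc (suc _))   → copyVal D₂ (λ q → V M q w) p }
    }

  Sat : (M : Model) → W M → Form → Set
  Sat M w top          = ⊤
  Sat M w (atom p)     = V M p w
  Sat M w (neg' φ)     = ¬ Sat M w φ
  Sat M w (and' φ ψ)   = Sat M w φ × Sat M w ψ
  Sat M w (box φ)      = ∀ (v : W M) → R M w v → Sat M v φ
  Sat M w (forget π φ) = ∀ (D₁ D₂ : Clause) → InC π D₁ → InC (pneg π) D₂ →
                         Sat (update M D₁ D₂) (w , zero) φ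

  Valid : Form → Set₁
  Valid φ = ∀ (M : Model) (w : W M) → Sat M w φ

-- The right-to-left direction is trivial: without successors every box holds.
-- For the other direction, let v be a successor of w. Take D₁ ∈ 𝒞(π) and
-- D₂ ∈ 𝒞(¬π); both sets are non-empty because π is neither a tautology nor a
-- contradiction. The copy (v , i) of v makes every literal of Dᵢ false (it
-- is non-tautological), so it refutes the formula entailing Dᵢ: (v , 1)
-- refutes π and (v , 2) refutes ¬π. Hence neither □π nor □¬π holds at
-- (w , 0), contradicting [‡π](□¬π ∨ □π). The argument is classical, but its
-- conclusion ⊥ is stable under double negation, so everything is done in
-- the double-negation monad.
module Submission where

open import Defs
open import Data.Bool using (true; false; not; _∧_)
import Data.Bool.Properties as Bool
open import Data.Empty using (⊥)
open import Data.Fin using (zero; suc)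
open import Data.List using (List; []; _∷_; _++_; map; filter; length)
open import Data.List.Membership.Propositional using (_∈_; find)
open import Data.List.Membership.Propositional.Properties using (∈-map⁻; ∈-filter⁺)
import Data.List.Membership.DecPropositional as DecMembership
open import Data.List.Properties using (filter-notAll)
open import Data.List.Relation.Binary.Subset.Propositional using (_⊆_)
open import Data.List.Relation.Binary.Subset.Propositional.Properties
  using (Any-resp-⊆; xs⊆xs++ys; xs⊆ys++xs; filter-⊆)
open import Data.List.Relation.Unary.All as All using (All; all?)
open import Data.List.Relation.Unary.All.Properties using (¬All⇒Any¬; ++⁻ˡ; ++⁻ʳ)
open import Data.List.Relation.Unary.Any using (Any; here; there)
import Data.List.Relation.Unary.Any.Properties as Any
import Data.Nat as ℕ
open import Data.Nat.Induction using (<-wellFounded)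
open import Data.Product using (Σ; ∃; _×_; _,_; proj₂)
open import Data.Sum using ([_,_]; inj₁; inj₂)
open import Data.Product.Function.NonDependent.Propositional using (_×-⇔_)
open import Data.Unit using (tt)
open import Effect.Monad using (RawMonad)
open import Level using (0ℓ)
open import Function using (const; _∘_)
open import Function.Bundles using (_⇔_; mk⇔; mk↣; Equivalence)
import Function.Properties.Equivalence as ⇔
open import Function.Related.TypeIsomorphisms using (¬-cong-⇔)
open import Induction.WellFounded using (Acc; acc)
open import Relation.Binary.Definitions using (DecidableEquality)
open import Relation.Binary.PropositionalEquality using (_≡_; _≢_; refl; sym; trans; cong; cong₂)
open import Relation.Nullary using (¬_; Dec; yes; no; contradiction)
open import Relation.Nullary.Decidable using (via-injection; ¬¬-excluded-middle)
open import Relation.Nullary.Negation using (¬¬-Monad)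

open Equivalence using (to; from)
open RawMonad (¬¬-Monad {a = 0ℓ})

countable⇒decidableEquality : {A : Set} → Countable A → DecidableEquality A
countable⇒decidableEquality (f , f-injective) = via-injection (mk↣ f-injective) ℕ._≟_

not≡true⇔≢true : ∀ x → not x ≡ true ⇔ (x ≢ true)
not≡true⇔≢true false = mk⇔ (λ _ ()) (const refl)
not≡true⇔≢true true  = mk⇔ (λ ()) (λ x≢true → contradiction refl x≢true)

∧≡true⇔ : ∀ x {y} → x ∧ y ≡ true ⇔ (x ≡ true × y ≡ true)
∧≡true⇔ true  = mk⇔ (refl ,_) proj₂
∧≡true⇔ false = mk⇔ (λ ()) (λ ())

module _ {At : Set} where

  atoms : PForm {At} → List At
  atoms ptop       = []
  atoms (patom p)  = p ∷ []
  atoms (pneg π)   = atoms π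
  atoms (pand π ρ) = atoms π ++ atoms ρ

  evalP-cong : ∀ {v v'} (π : PForm) → All (λ p → v p ≡ v' p) (atoms π) →
               evalP v π ≡ evalP v' π
  evalP-cong ptop       _              = refl
  evalP-cong (patom p)  (eq All.∷ _)   = eq
  evalP-cong (pneg π)   eqs            = cong not (evalP-cong π eqs)
  evalP-cong (pand π ρ) eqs            =
    cong₂ _∧_ (evalP-cong π (++⁻ˡ (atoms π) eqs)) (evalP-cong ρ (++⁻ʳ (atoms π) eqs))

  evalP-differs⇒atom-differs : ∀ {v v'} (π : PForm) → evalP v π ≢ evalP v' π →
                               Any (λ p → v p ≢ v' p) (atoms π)
  evalP-differs⇒atom-differs {v} {v'} π differs with all? (λ p → v p Bool.≟ v' p) (atoms π)
  ... | yes agree = contradiction (evalP-cong π agree) differs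
  ... | no ¬agree = ¬All⇒Any¬ (λ p → v p Bool.≟ v' p) (atoms π) ¬agree

  ¬Contradiction⇒¬Tautology-pneg : (π : PForm {At}) → ¬ Contradiction π →
                                   ¬ Tautology (pneg π)
  ¬Contradiction⇒¬Tautology-pneg π ¬contra taut = ¬contra (λ v → Bool.not-injective (taut v))

  ¬¬-falsifying-valuation : (π : PForm {At}) → ¬ Tautology π →
                            ¬ ¬ Σ Valuation (λ v → evalP v π ≡ false)
  ¬¬-falsifying-valuation π ¬taut ¬falsifiable =
    ¬taut (λ v → Bool.¬-not (λ eq → ¬falsifiable (v , eq)))

  falsifiedLiteral : Valuation {At} → At → Literal
  falsifiedLiteral v p with v p
  ... | true  = neg p
  ... | false = pos p

  falsifiedLiteral-true : ∀ {v v'} p → v p ≢ v' p → litVal v' (falsifiedLiteral v p) ≡ true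
  falsifiedLiteral-true {v} {v'} p differs with v p
  ... | true  with v' p
  ...   | true  = contradiction refl differs
  ...   | false = refl
  falsifiedLiteral-true {v} {v'} p differs | false with v' p
  ...   | true  = refl
  ...   | false = contradiction refl differs

  pos∈falsifiedLiteral : ∀ {v p q} → pos p ≡ falsifiedLiteral v q → v p ≡ false
  pos∈falsifiedLiteral {v} {p} {q} eq with v q in vq
  pos∈falsifiedLiteral refl | false = vq

  neg∈falsifiedLiteral : ∀ {v p q} → neg p ≡ falsifiedLiteral v q → v p ≡ true
  neg∈falsifiedLiteral {v} {p} {q} eq with v q in vq
  neg∈falsifiedLiteral refl | true = vq

  falsifiedClause : Valuation {At} → List At → Clause
  falsifiedClause v = map (falsifiedLiteral v)

  falsifiedClause-nonTautological : ∀ v xs → ¬ Tautological (falsifiedClause v xs)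
  falsifiedClause-nonTautological v xs (p , pos∈ , neg∈) =
    let _ , _ , pos≡ = ∈-map⁻ (falsifiedLiteral v) pos∈
        _ , _ , neg≡ = ∈-map⁻ (falsifiedLiteral v) neg∈
    in Bool.not-¬ (pos∈falsifiedLiteral {v} pos≡) (neg∈falsifiedLiteral {v} neg≡)

  falsifiedClause-entailed : ∀ v (π : PForm) → evalP v π ≡ false →
                             Entails π (falsifiedClause v (atoms π))
  falsifiedClause-entailed v π refuted v' satisfied =
    Any.gmap (λ {p} → falsifiedLiteral-true {v} {v'} p)
             (evalP-differs⇒atom-differs {v} {v'} π (λ eq → Bool.not-¬ refuted (trans eq satisfied)))

  tautological-mono : ∀ {D D'} → D ⊆ D' → Tautological {At} D → Tautological D'
  tautological-mono D⊆D' (p , pos∈ , neg∈) = p , D⊆D' pos∈ , D⊆D' neg∈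

  entails-mono : ∀ {π D D'} → D ⊆ D' → Entails {At} π D → Entails π D'
  entails-mono D⊆D' entailed v satisfied = Any-resp-⊆ D⊆D' (entailed v satisfied)

  -- Such a b exists only classically: S p need not be decidable.
  Represents : (At → Set) → Valuation {At} → List At → Set
  Represents S b xs = ∀ p → p ∈ xs → S p ⇔ (b p ≡ true)

  sat-embed⇔evalP : (M : Model) (x : W M) (b : Valuation) (π : PForm) →
                    Represents (λ p → V M p x) b (atoms π) →
                    Sat M x (embed π) ⇔ (evalP b π ≡ true)
  sat-embed⇔evalP M x b ptop       rep = mk⇔ (const refl) (const tt)
  sat-embed⇔evalP M x b (patom p)  rep = rep p (here refl)
  sat-embed⇔evalP M x b (pneg π)   rep =
    ⇔.trans (¬-cong-⇔ (sat-embed⇔evalP M x b π rep)) (⇔.sym (not≡true⇔≢true (evalP b π)))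
  sat-embed⇔evalP M x b (pand π ρ) rep =
    ⇔.trans (sat-embed⇔evalP M x b π (λ p → rep p ∘ xs⊆xs++ys (atoms π) (atoms ρ))
               ×-⇔ sat-embed⇔evalP M x b ρ (λ p → rep p ∘ xs⊆ys++xs (atoms ρ) (atoms π)))
            (⇔.sym (∧≡true⇔ (evalP b π)))

  module DecidableAtoms (_≟_ : DecidableEquality At) where

    _≟ₗ_ : DecidableEquality (Literal {At})
    pos p ≟ₗ pos q with p ≟ q
    ... | yes refl = yes refl
    ... | no  p≢q  = no λ { refl → p≢q refl }
    pos p ≟ₗ neg q = no λ ()
    neg p ≟ₗ pos q = no λ ()
    neg p ≟ₗ neg q with p ≟ q
    ... | yes refl = yes refl
    ... | no  p≢q  = no λ { refl → p≢q refl }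

    open DecMembership _≟ₗ_ using (_∈?_)

    ¬¬-representing-valuation : (S : At → Set) (xs : List At) →
                                ¬ ¬ Σ Valuation (λ b → Represents S b xs)
    ¬¬-representing-valuation S []       = return ((λ _ → false) , λ _ ())
    ¬¬-representing-valuation S (p ∷ ps) = do
      b , rep ← ¬¬-representing-valuation S ps
      Sp? ← ¬¬-excluded-middle
      return (extend b Sp? , extend-represents rep Sp?)
      where
        extend : Valuation → Dec (S p) → Valuation
        extend b Sp? q with q ≟ p | Sp?
        ... | yes _ | yes _ = true
        ... | yes _ | no  _ = false
        ... | no  _ | _     = b q

        extend-represents : ∀ {b} → Represents S b ps → (Sp? : Dec (S p)) →
                            Represents S (extend b Sp?) (p ∷ ps)
        extend-represents {b} rep Sp? q q∈ with q ≟ p | Sp? | q∈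
        ... | yes refl | yes Sp  | _          = mk⇔ (const refl) (const Sp)
        ... | yes refl | no  ¬Sp | _          = mk⇔ (λ Sp → contradiction Sp ¬Sp) (λ ())
        ... | no  q≢p  | _       | here q≡p   = contradiction q≡p q≢p
        ... | no  _    | _       | there q∈ps = rep q q∈ps

    infixl 7 _∩_
    _∩_ : Clause → Clause → Clause
    D ∩ D' = filter (_∈? D') D

    ⊆-∩ : ∀ {D D'} → D' ⊆ D → D' ⊆ D ∩ D'
    ⊆-∩ D'⊆D l∈D' = ∈-filter⁺ (_∈? _) (D'⊆D l∈D') l∈D'

    ∩-shorter : ∀ D {D'} → ¬ (D ⊆ D') → length (D ∩ D') ℕ.< length D
    ∩-shorter D {D'} D⊈D' with all? (_∈? D') D
    ... | yes D⊆D' = contradiction (λ {l} → All.lookup D⊆D' {l}) D⊈D'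
    ... | no ¬D⊆D' = filter-notAll (_∈? D') D (¬All⇒Any¬ (_∈? D') D ¬D⊆D')

    -- A strictly smaller entailed clause D' is replaced by D ∩ D', which is
    -- shorter than D even when D' itself is not.
    ¬¬-minimise : ∀ π D → Acc ℕ._<_ (length D) → ¬ Tautological D → Entails π D →
                  ¬ ¬ ∃ (InC π)
    ¬¬-minimise π D (acc shorter) ¬tautD entD =
      ¬¬-excluded-middle {A = ∃ λ D' → D' ⊊ D × Entails π D'} >>= λ where
      (no ¬smaller) → return (D , ¬tautD , entD , λ D' D'⊊D entD' → ¬smaller (D' , D'⊊D , entD'))
      (yes (D' , (D'⊆D , D⊈D') , entD')) →
        ¬¬-minimise π (D ∩ D') (shorter (∩-shorter D D⊈D'))
                    (¬tautD ∘ tautological-mono (filter-⊆ (_∈? D') D))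
                    (entails-mono {π} (⊆-∩ D'⊆D) entD')

    ¬¬-InC : (π : PForm) → ¬ Tautology π → ¬ ¬ ∃ (InC π)
    ¬¬-InC π ¬taut = do
      v , refuted ← ¬¬-falsifying-valuation π ¬taut
      let D = falsifiedClause v (atoms π)
      ¬¬-minimise π D (<-wellFounded (length D)) (falsifiedClause-nonTautological v (atoms π))
                  (falsifiedClause-entailed v π refuted)

    falsify : Clause → Valuation → Valuation
    falsify D c p with neg p ∈? D | pos p ∈? D
    ... | yes _ | _     = true
    ... | no  _ | yes _ = false
    ... | no  _ | no  _ = c p

    copyVal-represented : ∀ {S c xs} D → Represents S c xs →
                          Represents (copyVal D S) (falsify D c) xs
    copyVal-represented {S} {c} D rep p p∈ with neg p ∈? D | pos p ∈? D
    ... | yes neg∈ | _        = mk⇔ (const refl) (const (inj₁ neg∈))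
    ... | no  neg∉ | yes pos∈ =
      mk⇔ [ (λ neg∈ → contradiction neg∈ neg∉) , (λ (pos∉ , _) → contradiction pos∈ pos∉) ] (λ ())
    ... | no  neg∉ | no  pos∉ =
      mk⇔ [ (λ neg∈ → contradiction neg∈ neg∉) , to (rep p p∈) ∘ proj₂ ∘ proj₂ ]
          (λ cp → inj₂ (pos∉ , neg∉ , from (rep p p∈) cp))

    falsify-neg : ∀ {D p} c → neg p ∈ D → falsify D c p ≡ true
    falsify-neg {D} {p} c neg∈ with neg p ∈? D
    ... | yes _    = refl
    ... | no  neg∉ = contradiction neg∈ neg∉

    falsify-pos : ∀ {D p} c → ¬ Tautological D → pos p ∈ D → falsify D c p ≡ false
    falsify-pos {D} {p} c ¬taut pos∈ with neg p ∈? D | pos p ∈? D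
    ... | yes neg∈ | _        = contradiction (p , pos∈ , neg∈) ¬taut
    ... | no  _    | yes _    = refl
    ... | no  _    | no  pos∉ = contradiction pos∈ pos∉

    falsify-falsifies : ∀ {D} c → ¬ Tautological D → ¬ ClauseTrue (falsify D c) D
    falsify-falsifies c ¬taut satisfied with find satisfied
    ... | pos p , pos∈ , true-lit = Bool.not-¬ (falsify-pos c ¬taut pos∈) true-lit
    ... | neg p , neg∈ , true-lit = Bool.not-¬ (cong not (falsify-neg c neg∈)) true-lit

    ¬sat-falsified-implicate : ∀ {D c} ρ (N : Model) (y : W N) → ¬ Tautological D → Entails ρ D →
                               Represents (λ p → V N p y) (falsify D c) (atoms ρ) →
                               ¬ Sat N y (embed ρ)
    ¬sat-falsified-implicate {D} {c} ρ N y ¬taut entailed rep =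
      falsify-falsifies c ¬taut ∘ entailed (falsify D c) ∘ to (sat-embed⇔evalP N y (falsify D c) ρ rep)

    successor-refutes-forget-□¬∨□ : ∀ π → ¬ Tautology π → ¬ Contradiction π →
                                   (M : Model) {w v : W M} → R M w v →
                                   ¬ Sat M w (forget π (or' (box (neg' (embed π))) (box (embed π))))
    successor-refutes-forget-□¬∨□ π ¬taut ¬contra M {w} {v} wRv forgotten = ¬¬⊥ λ absurd → absurd
      where
        ¬¬⊥ : ¬ ¬ ⊥
        ¬¬⊥ = do
          c , rep ← ¬¬-representing-valuation (λ p → V M p v) (atoms π)
          D₁ , in₁@(¬taut₁ , ent₁ , _) ← ¬¬-InC π ¬taut
          D₂ , in₂@(¬taut₂ , ent₂ , _) ← ¬¬-InC (pneg π) (¬Contradiction⇒¬Tautology-pneg π ¬contra)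
          let N = update M D₁ D₂
              ¬□π : ¬ Sat N (w , zero) (box (embed π))
              ¬□π □π = ¬sat-falsified-implicate π N (v , suc zero) ¬taut₁ ent₁
                         (copyVal-represented D₁ rep) (□π (v , suc zero) wRv)
              ¬□¬π : ¬ Sat N (w , zero) (box (neg' (embed π)))
              ¬□¬π □¬π = ¬sat-falsified-implicate (pneg π) N (v , suc (suc zero)) ¬taut₂ ent₂
                           (copyVal-represented D₂ rep) (□¬π (v , suc (suc zero)) wRv)
          return (forgotten D₁ D₂ in₁ in₂ (¬□¬π , ¬□π))

proposition11 : (At : Set) → At → Countable At →
    (π : PForm {At}) → ¬ Tautology π → ¬ Contradiction π →
    Valid (iff (forget π (or' (box (neg' (embed π))) (box (embed π)))) (box bot))
proposition11 At _ countable π ¬taut ¬contra M w = forget⇒□⊥ , □⊥⇒forget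
  where
    open DecidableAtoms {At} (countable⇒decidableEquality countable)

    φ : Form
    φ = forget π (or' (box (neg' (embed π))) (box (embed π)))

    forget⇒□⊥ : Sat M w (imp φ (box bot))
    forget⇒□⊥ (forgotten , ¬□⊥) =
      ¬□⊥ (λ _ wRv _ → successor-refutes-forget-□¬∨□ π ¬taut ¬contra M wRv forgotten)

    □⊥⇒forget : Sat M w (imp (box bot) φ)
    □⊥⇒forget (□⊥ , ¬forgotten) =
      ¬forgotten (λ _ _ _ _ (¬□¬π , _) → ¬□¬π (λ (v , _) wRv → contradiction tt (□⊥ v wRv)))
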